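{- Let $(A,\sigma)$ be a state BL-algebra. Then $\sigma(\mathrm{Rad}(A))\supseteq\mathrm{Rad}(\sigma(A))=\sigma(\mathrm{Rad}_\sigma(A))$.
   Context: A BL-algebra is an algebra $(A,\wedge,\vee,\odot,\to,0,1)$ of type $(2,2,2,2,0,0)$ such that $(A,\wedge,\vee,0,1)$ is a bounded lattice, $(A,\odot,1)$ is a commutative monoid, and for all $a,b,c\in A$: $c\le a\to b$ iff $a\odot c\le b$; $a\wedge b=a\odot(a\to b)$; $(a\to b)\vee(b\to a)=1$. A state-operator on $A$ is a map $\sigma:A\to A$ such that for all $x,y\in A$: (1) $\sigma(0)=0$; (2) $\sigma(x\to y)=\sigma(x)\to\sigma(x\wedge y)$; (3) $\sigma(x\odot y)=\sigma(x)\odot\sigma(x\to x\odot y)$; (4) $\sigma(\sigma(x)\odot\sigma(y))=\sigma(x)\odot\sigma(y)$; (5) $\sigma(\sigma(x)\to\sigma(y))=\sigma(x)\to\sigma(y)$. The image $\sigma(A)$ is a subalgebra, regarded as a BL-algebra. A filter is a nonempty subset closed under $\odot$ and upward closed; a maximal filter is a proper filter not strictly contained in another proper filter; $\mathrm{Rad}(B)$ is the intersection of all maximal filters of a BL-algebra $B$. A state-filter is a filter $F$ of $A$ with $\sigma(F)\subseteq F$; a maximal state-filter is a proper state-filter not properly contained in any other proper state-filter; $\mathrm{Rad}_\sigma(A)$ is the intersection of all maximal state-filters of $(A,\sigma)$. -}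

module Defs where

open import Level using (0ℓ) renaming (suc to lsuc)
open import Data.Product using (Σ; _×_; _,_; ∃)
open import Relation.Nullary using (¬_)
open import Relation.Binary.PropositionalEquality using (_≡_)
open import Algebra.Lattice.Structures using (IsLattice)
open import Algebra.Structures using (IsCommutativeMonoid)

record BLAlgebra : Set₁ where
  infixr 7 _∧_
  infixr 6 _∨_
  infixl 8 _⊙_
  infixr 5 _⇒_
  infix  4 _≤_
  field
    Carrier : Set
    _∧_ _∨_ _⊙_ _⇒_ : Carrier → Carrier → Carrier
    𝟘 𝟙 : Carrier

  _≤_ : Carrier → Carrier → Set
  x ≤ y = x ∧ y ≡ x

  field
    isLattice : IsLattice _≡_ _∨_ _∧_
    𝟘-least   : ∀ x → 𝟘 ≤ x
    𝟙-greatest : ∀ x → x ≤ 𝟙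
    isCommMonoid : IsCommutativeMonoid _≡_ _⊙_ 𝟙
    residuation-⇒ : ∀ a b c → c ≤ a ⇒ b → a ⊙ c ≤ b
    residuation-⇐ : ∀ a b c → a ⊙ c ≤ b → c ≤ a ⇒ b
    divisibility : ∀ a b → a ∧ b ≡ a ⊙ (a ⇒ b)
    prelinearity : ∀ a b → (a ⇒ b) ∨ (b ⇒ a) ≡ 𝟙

record IsStateOperator (A : BLAlgebra) (σ : BLAlgebra.Carrier A → BLAlgebra.Carrier A) : Set where
  open BLAlgebra A
  field
    σ-𝟘 : σ 𝟘 ≡ 𝟘
    σ-⇒ : ∀ x y → σ (x ⇒ y) ≡ σ x ⇒ σ (x ∧ y)
    σ-⊙ : ∀ x y → σ (x ⊙ y) ≡ σ x ⊙ σ (x ⇒ x ⊙ y)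
    σ-σ⊙ : ∀ x y → σ (σ x ⊙ σ y) ≡ σ x ⊙ σ y
    σ-σ⇒ : ∀ x y → σ (σ x ⇒ σ y) ≡ σ x ⇒ σ y

record StateBLAlgebra : Set₁ where
  field
    bl : BLAlgebra
    σ  : BLAlgebra.Carrier bl → BLAlgebra.Carrier bl
    isState : IsStateOperator bl σ
  open BLAlgebra bl public

module _ {X : Set} where

  _⊆_ : ∀ {ℓ₁ ℓ₂} → (X → Set ℓ₁) → (X → Set ℓ₂) → Set _
  P ⊆ Q = ∀ x → P x → Q x

  _≐_ : ∀ {ℓ₁ ℓ₂} → (X → Set ℓ₁) → (X → Set ℓ₂) → Set _
  P ≐ Q = (P ⊆ Q) × (Q ⊆ P)

  image : ∀ {ℓ} → (X → X) → (X → Set ℓ) → X → Set ℓ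
  image f P y = Σ X λ x → P x × (f x ≡ y)

  Full : X → Set
  Full _ = Data.Unit.⊤
    where import Data.Unit

-- Filters of a subalgebra B ⊆ A (given by its underlying subset S of A,
-- closed under the operations).  A subset of B is represented by a predicate F on A with F ⊆ S.

module _ (A : BLAlgebra) where
  open BLAlgebra A

  record IsFilterIn (S F : Carrier → Set) : Set where
    field
      inside    : F ⊆ S
      nonempty  : ∃ λ x → F x
      ⊙-closed  : ∀ x y → F x → F y → F (x ⊙ y)
      up-closed : ∀ x y → F x → S y → x ≤ y → F y

  IsProperFilterIn : (S F : Carrier → Set) → Set
  IsProperFilterIn S F = IsFilterIn S F × ¬ (S ⊆ F)

  IsMaximalFilterIn : (S F : Carrier → Set) → Set₁
  IsMaximalFilterIn S F =
    IsProperFilterIn S F ×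
    (∀ (G : Carrier → Set) → IsProperFilterIn S G → F ⊆ G → G ⊆ F)

  RadIn : (S : Carrier → Set) → Carrier → Set₁
  RadIn S x = S x × (∀ (F : Carrier → Set) → IsMaximalFilterIn S F → F x)

  IsFilter : (Carrier → Set) → Set
  IsFilter = IsFilterIn Full

  IsMaximalFilter : (Carrier → Set) → Set₁
  IsMaximalFilter = IsMaximalFilterIn Full

  Rad : Carrier → Set₁
  Rad = RadIn Full

module _ (𝔸 : StateBLAlgebra) where
  open StateBLAlgebra 𝔸

  σA : Carrier → Set
  σA = image σ Full

  IsStateFilter : (Carrier → Set) → Set
  IsStateFilter F = IsFilter bl F × (image σ F ⊆ F)

  IsProperStateFilter : (Carrier → Set) → Set
  IsProperStateFilter F = IsStateFilter F × ¬ (Full ⊆ F)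

  IsMaximalStateFilter : (Carrier → Set) → Set₁
  IsMaximalStateFilter F =
    IsProperStateFilter F ×
    (∀ (G : Carrier → Set) → IsProperStateFilter G → F ⊆ G → G ⊆ F)

  Radσ : Carrier → Set₁
  Radσ x = ∀ (F : Carrier → Set) → IsMaximalStateFilter F → F x

  RadσA : Carrier → Set₁
  RadσA = RadIn bl σA

-- A maximal filter (or maximal state-filter) M of A meets σ(A) in a maximal filter of σ(A): a
-- proper filter G of σ(A) above M ∩ σ(A) generates together with M a proper (state-)filter of A,
-- since m ⊙ h = 0 would put ¬h into M ∩ σ(A) ⊆ G.  Conversely the preimage σ⁻¹(N) of a maximal
-- filter N of σ(A) is a maximal state-filter, because a state-filter G ⊇ σ⁻¹(N) traces a filter
-- G ∩ σ(A) ⊇ N on σ(A).  Since σ fixes σ(A) pointwise, both inclusions of radicals follow.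
module Submission where

open import Defs
open import Data.Product using (_×_; _,_; ∃₂; proj₁; proj₂)
open import Data.Unit using (tt)
open import Function using (_∘_)
open import Relation.Nullary using (¬_)
open import Relation.Binary.PropositionalEquality
  using (_≡_; refl; sym; trans; cong; subst; subst₂; module ≡-Reasoning)
open import Algebra.Bundles using (CommutativeMonoid)
open import Algebra.Lattice.Bundles using (Lattice)
open import Algebra.Structures using (IsCommutativeMonoid)
import Algebra.Properties.CommutativeSemigroup as CommutativeSemigroupProperties
import Algebra.Lattice.Properties.Lattice as LatticeProperties
open import Relation.Binary.Bundles using (Poset)

infixr 21 _∩_

_∩_ : {X : Set} → (X → Set) → (X → Set) → X → Set
(P ∩ Q) x = P x × Q x

module BLProperties (A : BLAlgebra) where
  open BLAlgebra A
  open IsCommutativeMonoid isCommMonoid using () renaming (comm to ⊙-comm; identityˡ to ⊙-identityˡ; identityʳ to ⊙-identityʳ)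
  open IsFilterIn

  lattice : Lattice _ _
  lattice = record { isLattice = isLattice }

  ⊙-commutativeMonoid : CommutativeMonoid _ _
  ⊙-commutativeMonoid = record { isCommutativeMonoid = isCommMonoid }

  open Lattice lattice using (∧-comm)
  open LatticeProperties lattice using () renaming (poset to ∧-poset)
  open CommutativeSemigroupProperties (CommutativeMonoid.commutativeSemigroup ⊙-commutativeMonoid)
    using () renaming (interchange to ⊙-interchange)

  -- The library's natural order reads x ≡ x ∧ y, the mirror image of _≤_.
  ≤-refl : ∀ {x} → x ≤ x
  ≤-refl = sym (Poset.refl ∧-poset)

  ≤-trans : ∀ {x y z} → x ≤ y → y ≤ z → x ≤ z
  ≤-trans p q = sym (Poset.trans ∧-poset (sym p) (sym q))

  ≤-antisym : ∀ {x y} → x ≤ y → y ≤ x → x ≡ y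
  ≤-antisym p q = Poset.antisym ∧-poset (sym p) (sym q)

  ≤-reflexive : ∀ {x y} → x ≡ y → x ≤ y
  ≤-reflexive refl = ≤-refl

  ⇒-self : ∀ x → x ⇒ x ≡ 𝟙
  ⇒-self x = ≤-antisym (𝟙-greatest _)
    (residuation-⇐ x x 𝟙 (≤-reflexive (⊙-identityʳ x)))

  x⊙y≤x : ∀ x y → x ⊙ y ≤ x
  x⊙y≤x x y = residuation-⇒ x x y (≤-trans (𝟙-greatest y) (≤-reflexive (sym (⇒-self x))))

  y≤x⇒x⊙y : ∀ x y → y ≤ x ⇒ x ⊙ y
  y≤x⇒x⊙y x y = residuation-⇐ x (x ⊙ y) y ≤-refl

  ⊙-monoʳ : ∀ x {y z} → y ≤ z → x ⊙ y ≤ x ⊙ z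
  ⊙-monoʳ x {z = z} y≤z = residuation-⇒ x (x ⊙ z) _ (≤-trans y≤z (y≤x⇒x⊙y x z))

  ⊙-mono : ∀ {x y u v} → x ≤ y → u ≤ v → x ⊙ u ≤ y ⊙ v
  ⊙-mono {x} {y} {u} {v} x≤y u≤v = ≤-trans (⊙-monoʳ x u≤v)
    (subst₂ _≤_ (⊙-comm v x) (⊙-comm v y) (⊙-monoʳ v x≤y))

  x⊙¬x≡𝟘 : ∀ x → x ⊙ (x ⇒ 𝟘) ≡ 𝟘
  x⊙¬x≡𝟘 x = begin
    x ⊙ (x ⇒ 𝟘)  ≡⟨ divisibility x 𝟘 ⟨
    x ∧ 𝟘        ≡⟨ ∧-comm x 𝟘 ⟩
    𝟘 ∧ x        ≡⟨ 𝟘-least x ⟩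
    𝟘            ∎
    where open ≡-Reasoning

  ⊙≤𝟘⇒≤¬ : ∀ {x y} → x ⊙ y ≤ 𝟘 → x ≤ y ⇒ 𝟘
  ⊙≤𝟘⇒≤¬ {x} {y} p = residuation-⇐ y 𝟘 x (subst (_≤ 𝟘) (⊙-comm x y) p)

  filter-𝟙 : ∀ {S F} → IsFilterIn A S F → S 𝟙 → F 𝟙
  filter-𝟙 F-filter S𝟙 with nonempty F-filter
  ... | x , Fx = up-closed F-filter x 𝟙 Fx S𝟙 (𝟙-greatest x)

  filter-𝟘⇒full : ∀ {S F} → IsFilterIn A S F → F 𝟘 → S ⊆ F
  filter-𝟘⇒full F-filter F𝟘 y Sy = up-closed F-filter 𝟘 y F𝟘 Sy (𝟘-least y)

  Join : (M G : Carrier → Set) → Carrier → Set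
  Join M G y = ∃₂ λ m h → M m × G h × m ⊙ h ≤ y

  Join-isFilter : ∀ {S M G} → IsFilter A M → IsFilterIn A S G → S 𝟙 → IsFilter A (Join M G)
  Join-isFilter M-filter G-filter S𝟙 = record
    { inside    = λ _ _ → tt
    ; nonempty  = 𝟙 , 𝟙 , 𝟙 , filter-𝟙 M-filter tt , filter-𝟙 G-filter S𝟙 , 𝟙-greatest _
    ; ⊙-closed  = λ { x y (m₁ , h₁ , Mm₁ , Gh₁ , m₁h₁≤x) (m₂ , h₂ , Mm₂ , Gh₂ , m₂h₂≤y) →
        m₁ ⊙ m₂ , h₁ ⊙ h₂ , ⊙-closed M-filter _ _ Mm₁ Mm₂ , ⊙-closed G-filter _ _ Gh₁ Gh₂ ,
        subst (_≤ x ⊙ y) (⊙-interchange m₁ h₁ m₂ h₂) (⊙-mono m₁h₁≤x m₂h₂≤y) }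
    ; up-closed = λ { x y (m , h , Mm , Gh , mh≤x) _ x≤y → m , h , Mm , Gh , ≤-trans mh≤x x≤y }
    }

  ⊆-Joinˡ : ∀ {S M G} → IsFilterIn A S G → S 𝟙 → M ⊆ Join M G
  ⊆-Joinˡ G-filter S𝟙 x Mx = x , 𝟙 , Mx , filter-𝟙 G-filter S𝟙 , ≤-reflexive (⊙-identityʳ x)

  ⊆-Joinʳ : ∀ {M G} → IsFilter A M → G ⊆ Join M G
  ⊆-Joinʳ M-filter x Gx = 𝟙 , x , filter-𝟙 M-filter tt , Gx , ≤-reflexive (⊙-identityˡ x)

module StateProperties (𝔸 : StateBLAlgebra) where
  open StateBLAlgebra 𝔸
  open IsStateOperator isState
  open IsCommutativeMonoid isCommMonoid using () renaming (identityʳ to ⊙-identityʳ)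
  open Lattice (BLProperties.lattice bl) using (∧-comm)
  open LatticeProperties (BLProperties.lattice bl) using (∧-idem)
  open BLProperties bl
  open IsFilterIn

  σ-𝟙 : σ 𝟙 ≡ 𝟙
  σ-𝟙 = begin
    σ 𝟙                ≡⟨ cong σ (⇒-self 𝟘) ⟨
    σ (𝟘 ⇒ 𝟘)          ≡⟨ σ-⇒ 𝟘 𝟘 ⟩
    σ 𝟘 ⇒ σ (𝟘 ∧ 𝟘)    ≡⟨ cong (λ t → σ 𝟘 ⇒ σ t) (∧-idem 𝟘) ⟩
    σ 𝟘 ⇒ σ 𝟘          ≡⟨ ⇒-self (σ 𝟘) ⟩
    𝟙                  ∎
    where open ≡-Reasoning

  σ-idem : ∀ x → σ (σ x) ≡ σ x
  σ-idem x = begin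
    σ (σ x)          ≡⟨ cong σ (⊙-identityʳ (σ x)) ⟨
    σ (σ x ⊙ 𝟙)      ≡⟨ cong (λ t → σ (σ x ⊙ t)) σ-𝟙 ⟨
    σ (σ x ⊙ σ 𝟙)    ≡⟨ σ-σ⊙ x 𝟙 ⟩
    σ x ⊙ σ 𝟙        ≡⟨ cong (σ x ⊙_) σ-𝟙 ⟩
    σ x ⊙ 𝟙          ≡⟨ ⊙-identityʳ (σ x) ⟩
    σ x              ∎
    where open ≡-Reasoning

  σ-mono : ∀ {x y} → x ≤ y → σ x ≤ σ y
  σ-mono {x} {y} x≤y = subst (λ t → σ t ≤ σ y) y⊙[y⇒x]≡x
    (subst (_≤ σ y) (sym (σ-⊙ y (y ⇒ x))) (x⊙y≤x (σ y) _))
    where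
    y⊙[y⇒x]≡x : y ⊙ (y ⇒ x) ≡ x
    y⊙[y⇒x]≡x = trans (sym (divisibility y x)) (trans (∧-comm y x) x≤y)

  σ⊙σ≤σ⊙ : ∀ x y → σ x ⊙ σ y ≤ σ (x ⊙ y)
  σ⊙σ≤σ⊙ x y = subst (σ x ⊙ σ y ≤_) (sym (σ-⊙ x y)) (⊙-monoʳ (σ x) (σ-mono (y≤x⇒x⊙y x y)))

  σA-fixed : ∀ {x} → σA 𝔸 x → σ x ≡ x
  σA-fixed (x , _ , refl) = σ-idem x

  σA-σ : ∀ x → σA 𝔸 (σ x)
  σA-σ x = x , tt , refl

  σA-𝟘 : σA 𝔸 𝟘
  σA-𝟘 = 𝟘 , tt , σ-𝟘

  σA-𝟙 : σA 𝔸 𝟙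
  σA-𝟙 = 𝟙 , tt , σ-𝟙

  σA-⊙ : ∀ {x y} → σA 𝔸 x → σA 𝔸 y → σA 𝔸 (x ⊙ y)
  σA-⊙ (x , _ , refl) (y , _ , refl) = σ x ⊙ σ y , tt , σ-σ⊙ x y

  σA-⇒ : ∀ {x y} → σA 𝔸 x → σA 𝔸 y → σA 𝔸 (x ⇒ y)
  σA-⇒ (x , _ , refl) (y , _ , refl) = σ x ⇒ σ y , tt , σ-σ⇒ x y

  ∩σA-isFilter : ∀ {F} → IsFilter bl F → IsFilterIn bl (σA 𝔸) (F ∩ σA 𝔸)
  ∩σA-isFilter F-filter = record
    { inside    = λ _ → proj₂
    ; nonempty  = 𝟙 , filter-𝟙 F-filter tt , σA-𝟙
    ; ⊙-closed  = λ x y (Fx , σAx) (Fy , σAy) → ⊙-closed F-filter x y Fx Fy , σA-⊙ σAx σAy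
    ; up-closed = λ x y (Fx , _) σAy x≤y → up-closed F-filter x y Fx tt x≤y , σAy
    }

  ∩σA-isProper : ∀ {F} → IsProperFilterIn bl Full F → IsProperFilterIn bl (σA 𝔸) (F ∩ σA 𝔸)
  ∩σA-isProper (F-filter , F-proper) =
    ∩σA-isFilter F-filter , λ σA⊆F → F-proper (filter-𝟘⇒full F-filter (proj₁ (σA⊆F 𝟘 σA-𝟘)))

  Join-isProper : ∀ {M G} → IsFilter bl M → IsProperFilterIn bl (σA 𝔸) G →
                  M ∩ σA 𝔸 ⊆ G → ¬ (Full ⊆ Join M G)
  Join-isProper {M} {G} M-filter (G-filter , G-proper) M∩σA⊆G Join-full
    using m , h , Mm , Gh , mh≤𝟘 ← Join-full 𝟘 tt = G-proper (filter-𝟘⇒full G-filter G𝟘)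
    where
    ¬h∈M : M (h ⇒ 𝟘)
    ¬h∈M = up-closed M-filter m _ Mm tt (⊙≤𝟘⇒≤¬ mh≤𝟘)
    ¬h∈G : G (h ⇒ 𝟘)
    ¬h∈G = M∩σA⊆G _ (¬h∈M , σA-⇒ (inside G-filter h Gh) σA-𝟘)
    G𝟘 : G 𝟘
    G𝟘 = subst G (x⊙¬x≡𝟘 h) (⊙-closed G-filter h _ Gh ¬h∈G)

  Join-σ-closed : ∀ {M G} → image σ M ⊆ M → G ⊆ σA 𝔸 → image σ (Join M G) ⊆ Join M G
  Join-σ-closed σM⊆M G⊆σA _ (y , (m , h , Mm , Gh , mh≤y) , refl) =
    σ m , h , σM⊆M _ (m , Mm , refl) , Gh ,
    subst (λ t → σ m ⊙ t ≤ σ y) (σA-fixed (G⊆σA h Gh)) (≤-trans (σ⊙σ≤σ⊙ m h) (σ-mono mh≤y))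

  ∩σA-isMaximal : ∀ {M} → IsProperFilterIn bl Full M →
    (∀ G → IsProperFilterIn bl (σA 𝔸) G → M ∩ σA 𝔸 ⊆ G → Join M G ⊆ M) →
    IsMaximalFilterIn bl (σA 𝔸) (M ∩ σA 𝔸)
  ∩σA-isMaximal M-proper Join⊆M = ∩σA-isProper M-proper , λ G G-proper M∩σA⊆G g Gg →
    Join⊆M G G-proper M∩σA⊆G g (⊆-Joinʳ (proj₁ M-proper) g Gg) , inside (proj₁ G-proper) g Gg

  maximalFilter⇒∩σA-maximal : ∀ {M} → IsMaximalFilter bl M → IsMaximalFilterIn bl (σA 𝔸) (M ∩ σA 𝔸)
  maximalFilter⇒∩σA-maximal (M-proper@(M-filter , _) , M-maximal) = ∩σA-isMaximal M-proper
    λ G (G-filter , G-proper) M∩σA⊆G → M-maximal (Join _ G)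
      ( Join-isFilter M-filter G-filter σA-𝟙
      , Join-isProper M-filter (G-filter , G-proper) M∩σA⊆G )
      (⊆-Joinˡ G-filter σA-𝟙)

  maximalStateFilter⇒∩σA-maximal : ∀ {M} → IsMaximalStateFilter 𝔸 M →
                                   IsMaximalFilterIn bl (σA 𝔸) (M ∩ σA 𝔸)
  maximalStateFilter⇒∩σA-maximal (((M-filter , σM⊆M) , M-proper) , M-maximal) =
    ∩σA-isMaximal (M-filter , M-proper) λ G (G-filter , G-proper) M∩σA⊆G → M-maximal (Join _ G)
      ( ( Join-isFilter M-filter G-filter σA-𝟙 , Join-σ-closed σM⊆M (inside G-filter) )
      , Join-isProper M-filter (G-filter , G-proper) M∩σA⊆G )
      (⊆-Joinˡ G-filter σA-𝟙)

  preimage-isMaximalStateFilter : ∀ {N} → IsMaximalFilterIn bl (σA 𝔸) N →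
                                  IsMaximalStateFilter 𝔸 (N ∘ σ)
  preimage-isMaximalStateFilter {N} ((N-filter , N-proper) , N-maximal) =
    ((preimage-isFilter , σ-closed) , preimage-proper) , preimage-maximal
    where
    N𝟙 : N 𝟙
    N𝟙 = filter-𝟙 N-filter σA-𝟙

    preimage-isFilter : IsFilter bl (N ∘ σ)
    preimage-isFilter = record
      { inside    = λ _ _ → tt
      ; nonempty  = 𝟙 , subst N (sym σ-𝟙) N𝟙
      ; ⊙-closed  = λ x y Nσx Nσy →
          up-closed N-filter _ _ (⊙-closed N-filter _ _ Nσx Nσy) (σA-σ (x ⊙ y)) (σ⊙σ≤σ⊙ x y)
      ; up-closed = λ x y Nσx _ x≤y → up-closed N-filter _ _ Nσx (σA-σ y) (σ-mono x≤y)
      }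

    σ-closed : image σ (N ∘ σ) ⊆ (N ∘ σ)
    σ-closed _ (x , Nσx , refl) = subst N (sym (σ-idem x)) Nσx

    preimage-proper : ¬ (Full ⊆ (N ∘ σ))
    preimage-proper full = N-proper (filter-𝟘⇒full N-filter (subst N σ-𝟘 (full 𝟘 tt)))

    preimage-maximal : ∀ G → IsProperStateFilter 𝔸 G → (N ∘ σ) ⊆ G → G ⊆ (N ∘ σ)
    preimage-maximal G ((G-filter , σG⊆G) , G-proper) N∘σ⊆G g Gg =
      G∩σA⊆N (σ g) (σG⊆G _ (g , Gg , refl) , σA-σ g)
      where
      N⊆G∩σA : N ⊆ G ∩ σA 𝔸
      N⊆G∩σA x Nx = N∘σ⊆G x (subst N (sym (σA-fixed σAx)) Nx) , σAx
        where σAx = inside N-filter x Nx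
      G∩σA⊆N : G ∩ σA 𝔸 ⊆ N
      G∩σA⊆N = N-maximal _ (∩σA-isProper (G-filter , G-proper)) N⊆G∩σA

  RadσA⊆σRad : RadσA 𝔸 ⊆ image σ (Rad bl)
  RadσA⊆σRad x (σAx , x∈maximal) =
    x , (tt , λ M M-maximal → proj₁ (x∈maximal _ (maximalFilter⇒∩σA-maximal M-maximal))) , σA-fixed σAx

  RadσA⊆σRadσ : RadσA 𝔸 ⊆ image σ (Radσ 𝔸)
  RadσA⊆σRadσ x (σAx , x∈maximal) =
    x , (λ M M-maximal → proj₁ (x∈maximal _ (maximalStateFilter⇒∩σA-maximal M-maximal))) , σA-fixed σAx

  σRadσ⊆RadσA : image σ (Radσ 𝔸) ⊆ RadσA 𝔸
  σRadσ⊆RadσA _ (x , x∈Radσ , refl) =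
    σA-σ x , λ N N-maximal → x∈Radσ _ (preimage-isMaximalStateFilter N-maximal)

proposition5p9 : (𝔸 : StateBLAlgebra) →
    let open StateBLAlgebra 𝔸 in
    (RadσA 𝔸 ⊆ image σ (Rad bl)) × (RadσA 𝔸 ≐ image σ (Radσ 𝔸))
proposition5p9 𝔸 = RadσA⊆σRad , RadσA⊆σRadσ , σRadσ⊆RadσA
  where open StateProperties 𝔸
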